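{- Suppose the precedence underlying $>_{\mathsf{pop*}}$ is admissible. If $s>_{\mathsf{pop*}}t$ and $s$ is a value, then $t$ is a safe subterm of $s$ modulo $\approx$; in particular $t$ is a value.
   Context: Terms over a finite signature $\mathcal{F}=\mathcal{D}\uplus\mathcal{C}$ (defined symbols, constructors) and variables $\mathcal{V}$; values are terms built from variables and constructors. A safe mapping gives each symbol a set of safe argument positions (all positions safe for constructors); write $f(s_1..s_k;s_{k+1}..s_{k+l})$ with the first $k$ normal. A precedence is a preorder $\succsim$ ($\succ$ strict, $\sim$ equivalence), admissible if $f\sim g$ implies both defined or both constructors. $s\approx t$ iff $s=t$ or $s=f(\vec s)$, $t=g(\vec t)$, $f\sim g$ and a permutation $\pi$ with $s_i\approx t_{\pi(i)}$ preserving normal/safe status. $\mathcal{T}(\mathcal{F}_{<f},\mathcal{V})$: terms over variables and symbols below $f$. For $s=f(s_1..s_{k+l})$: $s>_{\mathsf{sq}}t$ iff $s_i(>_{\mathsf{sq}}\cup\approx)t$ for some $i$ (normal if $f\in\mathcal{D}$) or $f\in\mathcal{D}$, $t=g(t_1..t_p)$, $f\succ g$, $s>_{\mathsf{sq}}t_i$ for all $i$. $s>_{\mathsf{pop*}}t$ iff (1) $s_i\ge_{\mathsf{pop*}}t$ for some $i$; (2) $f\in\mathcal{D}$, $t=g(t_1..t_m;t_{m+1}..t_{m+n})$, $f\succ g$, $s>_{\mathsf{sq}}t_j$ for normal $j$, $s>_{\mathsf{pop*}}t_j$ for safe $j$, at most one safe $t_j\notin\mathcal{T}(\mathcal{F}_{<f},\mathcal{V})$;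 or (3) $f\in\mathcal{D}$, $f\sim g$, normal arguments decrease in the strict and safe arguments in the weak multiset extension of $>_{\mathsf{pop*}}$ (modulo $\approx$); $\ge_{\mathsf{pop*}}={>_{\mathsf{pop*}}}\cup\approx$. A safe subterm of $s$ is $s$ itself or a safe subterm of a term at a safe argument position of $s$ (for values, every subterm). -}

module Defs where

open import Data.Nat using (ℕ)
open import Data.Bool using (Bool; true; false; not)
open import Data.Fin using (Fin)
open import Data.Fin.Permutation using (Permutation; _⟨$⟩ʳ_)
open import Data.List using (List; []; _∷_; _++_; map; allFin; filterᵇ)
open import Data.List.Relation.Unary.All using (All)
open import Data.List.Relation.Unary.Any using (Any)
open import Data.List.Relation.Binary.Pointwise using (Pointwise)
open import Data.List.Relation.Binary.Permutation.Propositional using (_↭_)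
open import Data.Product using (Σ; ∃; _×_; _,_)
open import Data.Sum using (_⊎_)
open import Relation.Nullary using (¬_)
open import Relation.Binary.PropositionalEquality using (_≡_)
open import Function.Bundles using (_↔_)

-- A finite signature F = D ⊎ C: `defined f ≡ true` means f ∈ D,
-- `defined f ≡ false` means f ∈ C (constructor).
record Signature : Set₁ where
  field
    Sym     : Set
    arity   : Sym → ℕ
    defined : Sym → Bool
    finite  : Σ ℕ (λ n → Sym ↔ Fin n)

record SafeMapping (Sg : Signature) : Set₁ where
  open Signature Sg
  field
    safe       : (f : Sym) → Fin (arity f) → Bool
    constrSafe : ∀ f i → defined f ≡ false → safe f i ≡ true

record Precedence (Sg : Signature) : Set₁ where
  open Signature Sg
  field
    _≿_    : Sym → Sym → Set
    ≿-refl  : ∀ {f} → f ≿ f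
    ≿-trans : ∀ {f g h} → f ≿ g → g ≿ h → f ≿ h

  _≻_ : Sym → Sym → Set
  f ≻ g = (f ≿ g) × ¬ (g ≿ f)

  _∼_ : Sym → Sym → Set
  f ∼ g = (f ≿ g) × (g ≿ f)

Admissible : {Sg : Signature} → Precedence Sg → Set
Admissible {Sg} P = ∀ {f g} → f ∼ g → defined f ≡ defined g
  where open Signature Sg
        open Precedence P

module POP (Sg : Signature) (SM : SafeMapping Sg) (P : Precedence Sg) (V : Set) where
  open Signature Sg
  open SafeMapping SM
  open Precedence P

  data Term : Set where
    var : V → Term
    fun : (f : Sym) → (Fin (arity f) → Term) → Term

  data Value : Term → Set where
    var : ∀ x → Value (var x)
    fun : ∀ {f ts} → defined f ≡ false → (∀ i → Value (ts i)) → Value (fun f ts)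

  data Below (f : Sym) : Term → Set where
    var : ∀ x → Below f (var x)
    fun : ∀ {g ts} → f ≻ g → (∀ i → Below f (ts i)) → Below f (fun g ts)

  infix 4 _≈_
  data _≈_ : Term → Term → Set where
    ≈-refl : ∀ {s} → s ≈ s
    ≈-fun  : ∀ {f g ss ts} → f ∼ g → (π : Permutation (arity f) (arity g)) →
             (∀ i → ss i ≈ ts (π ⟨$⟩ʳ i)) →
             (∀ i → safe f i ≡ safe g (π ⟨$⟩ʳ i)) →
             fun f ss ≈ fun g ts

  normalArgs : (f : Sym) → (Fin (arity f) → Term) → List Term
  normalArgs f ts = map ts (filterᵇ (λ i → not (safe f i)) (allFin (arity f)))

  safeArgs : (f : Sym) → (Fin (arity f) → Term) → List Term
  safeArgs f ts = map ts (filterᵇ (safe f) (allFin (arity f)))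

  MulWeak : (Term → Term → Set) → List Term → List Term → Set
  MulWeak R M N = Σ (List Term) λ X → Σ (List Term) λ Y → Σ (List Term) λ X' → Σ (List Term) λ Z →
    (M ↭ X ++ Y) × (N ↭ X' ++ Z) × Pointwise _≈_ X X' ×
    All (λ z → Any (λ y → R y z) Y) Z

  MulStrict : (Term → Term → Set) → List Term → List Term → Set
  MulStrict R M N = Σ (List Term) λ X → Σ (List Term) λ Y → Σ (List Term) λ X' → Σ (List Term) λ Z →
    (M ↭ X ++ Y) × (N ↭ X' ++ Z) × Pointwise _≈_ X X' × ¬ (Y ≡ []) ×
    All (λ z → Any (λ y → R y z) Y) Z

  infix 4 _>sq_
  data _>sq_ : Term → Term → Set where
    sq-sub  : ∀ {f ss t} (i : Fin (arity f)) → (defined f ≡ true → safe f i ≡ false) →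
              (ss i >sq t ⊎ ss i ≈ t) → fun f ss >sq t
    sq-prec : ∀ {f ss g ts} → defined f ≡ true → f ≻ g →
              (∀ i → fun f ss >sq ts i) → fun f ss >sq fun g ts

  infix 4 _>pop*_
  data _>pop*_ : Term → Term → Set where
    pop-sub  : ∀ {f ss t} (i : Fin (arity f)) →
               (ss i >pop* t ⊎ ss i ≈ t) → fun f ss >pop* t
    pop-prec : ∀ {f ss g ts} → defined f ≡ true → f ≻ g →
               (∀ j → safe g j ≡ false → fun f ss >sq ts j) →
               (∀ j → safe g j ≡ true → fun f ss >pop* ts j) →
               (∀ j k → safe g j ≡ true → ¬ Below f (ts j) →
                        safe g k ≡ true → ¬ Below f (ts k) → j ≡ k) →
               fun f ss >pop* fun g ts
    pop-epi  : ∀ {f ss g ts} → defined f ≡ true → f ∼ g →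
               MulStrict _>pop*_ (normalArgs f ss) (normalArgs g ts) →
               MulWeak _>pop*_ (safeArgs f ss) (safeArgs g ts) →
               fun f ss >pop* fun g ts

  data SafeSubterm : Term → Term → Set where
    here  : ∀ {s} → SafeSubterm s s
    there : ∀ {f ts u} (i : Fin (arity f)) → safe f i ≡ true →
            SafeSubterm u (ts i) → SafeSubterm u (fun f ts)

module Submission where

-- If s is a value, then s >pop* t can only arise from the subterm rule (1):
-- rules (2) and (3) require the root of s to be a defined symbol, whereas the
-- root of a value is a constructor.  Hence t is reached by descending into
-- arguments of s — all of which are safe positions of constructors — and
-- finishing with a step t' ≈ t.
--
-- For the second claim, t is a value because u is (every subterm of a value
-- is a value) and values are closed under ≈; the latter is where
-- admissibility enters: a symbol equivalent to a constructor is a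
-- constructor.

open import Defs
open import Data.Product using (Σ; _×_; _,_)
open import Data.Sum using (inj₁; inj₂)
open import Data.Bool using (true)
open import Data.Fin.Permutation using (flip; _⟨$⟩ˡ_; inverseʳ)
open import Relation.Binary.PropositionalEquality using (_≡_; _≢_; refl; sym; trans; subst; cong)

module ValueDecrease (Sg : Signature) (SM : SafeMapping Sg) (P : Precedence Sg) (V : Set) where
  open Signature Sg
  open SafeMapping SM
  open Precedence P
  open POP Sg SM P V

  -- ≈ is symmetric: invert the permutation and use that it preserves status.
  ≈-sym : ∀ {s t} → s ≈ t → t ≈ s
  ≈-sym ≈-refl = ≈-refl
  ≈-sym (≈-fun {g = g} {ss} {ts} (f≿g , g≿f) π args≈ status) =
    ≈-fun (g≿f , f≿g) (flip π) args≈⁻¹ status⁻¹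
    where
      args≈⁻¹ : ∀ j → ts j ≈ ss (π ⟨$⟩ˡ j)
      args≈⁻¹ j = subst (λ k → ts k ≈ ss (π ⟨$⟩ˡ j)) (inverseʳ π) (≈-sym (args≈ (π ⟨$⟩ˡ j)))

      status⁻¹ : ∀ j → safe g j ≡ safe _ (π ⟨$⟩ˡ j)
      status⁻¹ j = sym (trans (status (π ⟨$⟩ˡ j)) (cong (safe g) (inverseʳ π)))

  -- Under an admissible precedence, values are closed under ≈: the root of
  -- an equivalent term is ∼ to a constructor, hence itself a constructor.
  value-≈ : Admissible P → ∀ {s t} → Value s → s ≈ t → Value t
  value-≈ adm v ≈-refl = v
  value-≈ adm (fun f∈C args) (≈-fun {ts = ts} f∼g π args≈ _) =
    fun (trans (sym (adm f∼g)) f∈C) argsValue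
    where
      argsValue : ∀ j → Value (ts j)
      argsValue j = subst (λ k → Value (ts k)) (inverseʳ π)
                          (value-≈ adm (args (π ⟨$⟩ˡ j)) (args≈ (π ⟨$⟩ˡ j)))

  -- The root of a value is not a defined symbol, so rules (2) and (3),
  -- which demand a defined root, never apply to a value.
  constructor-root : ∀ {f ss} → Value (fun f ss) → defined f ≢ true
  constructor-root (fun f∈C _) f∈D with trans (sym f∈D) f∈C
  ... | ()

  value-descent : ∀ {s t} → s >pop* t → Value s → Σ Term (λ u → SafeSubterm u s × (t ≈ u))
  value-descent (pop-sub i (inj₁ ssᵢ>t)) (fun f∈C args)
    with value-descent ssᵢ>t (args i)
  ... | u , u⊴ssᵢ , t≈u = u , there i (constrSafe _ i f∈C) u⊴ssᵢ , t≈u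
  value-descent {fun f ss} (pop-sub i (inj₂ ssᵢ≈t)) (fun f∈C _) =
    ss i , there i (constrSafe f i f∈C) here , ≈-sym ssᵢ≈t
  value-descent (pop-prec f∈D _ _ _ _) v with constructor-root v f∈D
  ... | ()
  value-descent (pop-epi f∈D _ _ _) v with constructor-root v f∈D
  ... | ()

  value-subterm : ∀ {u s} → SafeSubterm u s → Value s → Value u
  value-subterm here v = v
  value-subterm (there i _ u⊴tsᵢ) (fun _ args) = value-subterm u⊴tsᵢ (args i)

lemma3p19 : (Sg : Signature) (SM : SafeMapping Sg) (P : Precedence Sg) (V : Set) →
    Admissible P →
    let open POP Sg SM P V in
    ∀ (s t : Term) → s >pop* t → Value s →
    Σ Term (λ u → SafeSubterm u s × (t ≈ u)) × Value t
lemma3p19 Sg SM P V adm s t s>t vs with ValueDecrease.value-descent Sg SM P V s>t vs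
... | u , u⊴s , t≈u = (u , u⊴s , t≈u) , value-≈ adm (value-subterm u⊴s vs) (≈-sym t≈u)
  where open ValueDecrease Sg SM P V
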